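{- For every integer $i\ge 0$ there is a polynomial $p_i$ of degree $i$, of the form $p_i(t)=\binom{t}{i}+\sum_{0\le n<i} c_n\binom{t}{n}$ with constants $c_n$, such that $d_i(t)=p_i(t)$ for all integers $t\ge 2i$.
   Context: For integers $t\ge 0$ and $0\le i\le t/2$ define $d_i(t)$ recursively by $d_0(t)=1$ for all $t\ge0$; for $i\ge1$ and $2i<t$: $d_i(t)=2d_{i-1}(t-1)+d_i(t-1)-d_{i-1}(t-2)$; for $i\ge 1$: $d_i(2i)=3d_{i-1}(2i-1)-d_{i-1}(2i-2)$. -}

module Defs where

open import Data.Nat using (ℕ; zero; suc; _*_; _<ᵇ_; _≡ᵇ_)
open import Data.Bool using (if_then_else_)
open import Data.Integer using (ℤ; +_) renaming (_+_ to _+ℤ_; _-_ to _-ℤ_; _*_ to _*ℤ_)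
open import Data.Fin using (Fin; toℕ)
open import Data.Nat.Combinatorics using (_C_)
open import Data.Rational using (ℚ) renaming (_+_ to _+ℚ_; _*_ to _*ℚ_)
import Data.Rational as Q
open import Relation.Nullary using (yes; no)

-- d i t, meaningful for 2i ≤ t; defined as 0 outside that domain (t < 2i).
-- Recursion on t.
d : ℕ → ℕ → ℤ
d zero t = + 1
d (suc i) zero = + 0
d (suc i) (suc zero) = + 0
d (suc i) (suc (suc t)) =
  if 2 * suc i <ᵇ suc (suc t)
  then (+ 2 *ℤ d i (suc t)) +ℤ d (suc i) (suc t) -ℤ d i t
  else (if 2 * suc i ≡ᵇ suc (suc t)
        then (+ 3 *ℤ d i (suc t)) -ℤ d i t
        else + 0)

binomℚ : ℕ → ℕ → ℚ
binomℚ t n = Q.fromℚᵘ (Data.Rational.Unnormalised.mkℚᵘ (+ (t C n)) 0)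
  where import Data.Rational.Unnormalised

sumBinom : (i : ℕ) → (Fin i → ℚ) → ℕ → ℚ
sumBinom zero c t = Q.0ℚ
sumBinom (suc i) c t = sumBinom i (λ k → c (Data.Fin.inject₁ k)) t +ℚ (c (Data.Fin.fromℕ i) *ℚ binomℚ t i)

pBinom : (i : ℕ) → (Fin i → ℚ) → ℕ → ℚ
pBinom i c t = binomℚ t i +ℚ sumBinom i c t

dℚ : ℕ → ℕ → ℚ
dℚ i t = Q._/_ (d i t) 1

-- Write  Poly k t₀ f  when f(t) = Σ_{n<k} a_n C(t,n) for all t ≥ t₀ and
-- some rational a_n, and  Monic k t₀ f  when f(t) − C(t,k) is Poly k t₀.
--  1. Poly k t₀ is closed under sums, scalar multiples, raising t₀ and
--     raising k, and contains C(t,n) for n < k.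
--  2. Backward shift: by Pascal's rule C(t−1,k) − C(t,k) is Poly k for t ≥ 1,
--     so Poly and Monic are preserved by f ↦ f ∘ pred (at the cost of t₀+1).
--  3. Summation: since Σ a_n C(t,n+1) is an antidifference of Σ a_n C(t,n),
--     if f(t+1) = f(t) + g(t) for t ≥ t₀ and g is Monic k then f is
--     Monic (k+1); the initial value f(t₀) is absorbed into the constant.
--  4. For t > 2(j+1) the recurrence reads
--       d_{j+1}(t+1) = d_{j+1}(t) + (2 d_j(t) − d_j(t−1)),
--     so by induction on i and 1–3, d_i is Monic i from t = 2i on.
module Submission where

open import Data.Bool.Properties using (T-≡)
open import Function using (Equivalence)
open import Data.Fin using (Fin; toℕ; inject₁; fromℕ)
open import Data.Fin.Properties using (toℕ-inject₁; toℕ-fromℕ)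
open import Data.Integer as ℤ using (ℤ; +_; -[1+_])
import Data.Integer.Properties as ℤP
open import Data.Nat as ℕ using (ℕ; zero; suc; pred; _*_; _≤_; _<_; _≤′_; ≤′-refl; ≤′-step; s≤s; z≤n)
import Data.Nat.Properties as ℕP
open import Data.Nat.Coprimality using (1-coprimeTo) renaming (sym to coprime-sym)
open import Data.Nat.Combinatorics using (_C_; nCk+nC[k+1]≡[n+1]C[k+1])
open import Data.Product using (Σ; _,_)
open import Data.Rational using (ℚ; mkℚ; 0ℚ; 1ℚ; _+_; _-_; -_) renaming (_*_ to _·_)
open import Data.Rational.Properties using (↥p/↧p≡p; +-comm)
open import Data.Rational.Solver using (module +-*-Solver)
open +-*-Solver
open import Relation.Binary.PropositionalEquality
open ≡-Reasoning
open import Defs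

ι : ℤ → ℚ
ι z = z Data.Rational./ 1

-- z as a rational in lowest terms; on this form the ring operations of ℚ
-- compute to the integer operations.
integral : ℤ → ℚ
integral z = mkℚ z 0 (coprime-sym (1-coprimeTo ℤ.∣ z ∣))

ι≡integral : ∀ z → ι z ≡ integral z
ι≡integral z = ↥p/↧p≡p (integral z)

ι-+ : ∀ x y → ι (x ℤ.+ y) ≡ ι x + ι y
ι-+ x y = begin
  ι (x ℤ.+ y)
    ≡⟨ cong ι (sym (cong₂ ℤ._+_ (ℤP.*-identityʳ x) (ℤP.*-identityʳ y))) ⟩
  integral x + integral y
    ≡⟨ sym (cong₂ _+_ (ι≡integral x) (ι≡integral y)) ⟩
  ι x + ι y ∎

ι-* : ∀ x y → ι (x ℤ.* y) ≡ ι x · ι y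
ι-* x y = sym (cong₂ _·_ (ι≡integral x) (ι≡integral y))

ι-neg : ∀ x → ι (ℤ.- x) ≡ - ι x
ι-neg (+ zero) = refl
ι-neg (+ suc n) = refl
ι-neg -[1+ n ] = trans (ι≡integral (+ suc n)) (cong -_ (sym (ι≡integral -[1+ n ])))

ι-- : ∀ x y → ι (x ℤ.- y) ≡ ι x - ι y
ι-- x y = trans (ι-+ x (ℤ.- y)) (cong (λ w → ι x + w) (ι-neg y))

pascal : ∀ t n → binomℚ (suc t) (suc n) ≡ binomℚ t (suc n) + binomℚ t n
pascal t n = begin
  ι (+ (suc t C suc n))             ≡⟨ cong (λ m → ι (+ m)) (sym (nCk+nC[k+1]≡[n+1]C[k+1] t n)) ⟩
  ι (+ (t C n) ℤ.+ + (t C suc n))   ≡⟨ ι-+ (+ (t C n)) (+ (t C suc n)) ⟩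
  binomℚ t n + binomℚ t (suc n)     ≡⟨ +-comm (binomℚ t n) (binomℚ t (suc n)) ⟩
  binomℚ t (suc n) + binomℚ t n     ∎

combo : ℕ → (ℕ → ℚ) → ℕ → ℚ
combo zero    a t = 0ℚ
combo (suc k) a t = combo k a t + a k · binomℚ t k

record Poly (k t₀ : ℕ) (f : ℕ → ℚ) : Set where
  constructor poly
  field
    coeff : ℕ → ℚ
    agree : ∀ t → t₀ ≤ t → f t ≡ combo k coeff t

Monic : ℕ → ℕ → (ℕ → ℚ) → Set
Monic k t₀ f = Poly k t₀ (λ t → f t - binomℚ t k)

combo-+ : ∀ k a b t → combo k a t + combo k b t ≡ combo k (λ n → a n + b n) t
combo-+ zero    a b t = refl
combo-+ (suc k) a b t = begin
  (combo k a t + a k · binomℚ t k) + (combo k b t + b k · binomℚ t k)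
    ≡⟨ solve 5 (λ A B x y c → (A :+ x :* c) :+ (B :+ y :* c) := (A :+ B) :+ (x :+ y) :* c)
         refl (combo k a t) (combo k b t) (a k) (b k) (binomℚ t k) ⟩
  (combo k a t + combo k b t) + (a k + b k) · binomℚ t k
    ≡⟨ cong (λ w → w + (a k + b k) · binomℚ t k) (combo-+ k a b t) ⟩
  combo (suc k) (λ n → a n + b n) t ∎

combo-· : ∀ k q a t → q · combo k a t ≡ combo k (λ n → q · a n) t
combo-· zero    q a t = solve 1 (λ q → q :* con 0ℚ := con 0ℚ) refl q
combo-· (suc k) q a t = begin
  q · (combo k a t + a k · binomℚ t k)
    ≡⟨ solve 4 (λ q A x c → q :* (A :+ x :* c) := q :* A :+ (q :* x) :* c)
         refl q (combo k a t) (a k) (binomℚ t k) ⟩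
  q · combo k a t + (q · a k) · binomℚ t k
    ≡⟨ cong (λ w → w + (q · a k) · binomℚ t k) (combo-· k q a t) ⟩
  combo (suc k) (λ n → q · a n) t ∎

combo-ext : ∀ k a b t → (∀ n → n < k → a n ≡ b n) → combo k a t ≡ combo k b t
combo-ext zero    a b t same = refl
combo-ext (suc k) a b t same =
  cong₂ (λ u v → u + v · binomℚ t k)
        (combo-ext k a b t (λ n n<k → same n (ℕP.m<n⇒m<1+n n<k)))
        (same k (ℕP.n<1+n k))

combo-zero : ∀ k t → combo k (λ _ → 0ℚ) t ≡ 0ℚ
combo-zero zero    t = refl
combo-zero (suc k) t = trans (cong (λ w → w + 0ℚ · binomℚ t k) (combo-zero k t))
                             (solve 1 (λ c → con 0ℚ :+ con 0ℚ :* c := con 0ℚ) refl (binomℚ t k))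

unit : ℕ → ℕ → ℚ
unit zero    zero    = 1ℚ
unit zero    (suc n) = 0ℚ
unit (suc k) zero    = 0ℚ
unit (suc k) (suc n) = unit k n

unit-diag : ∀ k → unit k k ≡ 1ℚ
unit-diag zero    = refl
unit-diag (suc k) = unit-diag k

unit-below : ∀ k n → n < k → unit k n ≡ 0ℚ
unit-below (suc k) zero    _       = refl
unit-below (suc k) (suc n) (s≤s p) = unit-below k n p

Poly-congr : ∀ {k t₀ f g} → (∀ t → t₀ ≤ t → f t ≡ g t) → Poly k t₀ f → Poly k t₀ g
Poly-congr f≡g (poly a h) = poly a (λ t p → trans (sym (f≡g t p)) (h t p))

Poly-raise : ∀ {k t₀ t₁ f} → t₀ ≤ t₁ → Poly k t₀ f → Poly k t₁ f
Poly-raise t₀≤t₁ (poly a h) = poly a (λ t p → h t (ℕP.≤-trans t₀≤t₁ p))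

Poly-+ : ∀ {k t₀ f g} → Poly k t₀ f → Poly k t₀ g → Poly k t₀ (λ t → f t + g t)
Poly-+ {k} (poly a h) (poly b h') =
  poly (λ n → a n + b n) (λ t p → trans (cong₂ _+_ (h t p) (h' t p)) (combo-+ k a b t))

Poly-· : ∀ {k t₀ f} q → Poly k t₀ f → Poly k t₀ (λ t → q · f t)
Poly-· {k} q (poly a h) =
  poly (λ n → q · a n) (λ t p → trans (cong (q ·_) (h t p)) (combo-· k q a t))

Poly-binom : ∀ k t₀ → Poly (suc k) t₀ (λ t → binomℚ t k)
Poly-binom k t₀ = poly (unit k) (λ t _ → sym (begin
  combo k (unit k) t + unit k k · binomℚ t k
    ≡⟨ cong₂ (λ u v → u + v · binomℚ t k)
             (trans (combo-ext k (unit k) (λ _ → 0ℚ) t (unit-below k)) (combo-zero k t))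
             (unit-diag k) ⟩
  0ℚ + 1ℚ · binomℚ t k
    ≡⟨ solve 1 (λ c → con 0ℚ :+ con 1ℚ :* c := c) refl (binomℚ t k) ⟩
  binomℚ t k ∎))

-- Degree < k implies degree < k+1: subtract the unused top term again.
Poly-embed : ∀ {k t₀ f} → Poly k t₀ f → Poly (suc k) t₀ f
Poly-embed {k} {t₀} {f} (poly a h) =
  Poly-congr (λ t _ → solve 3 (λ F x c → (F :+ x :* c) :+ (:- x) :* c := F)
                              refl (f t) (a k) (binomℚ t k))
             (Poly-+ (poly a (λ t p → cong (λ w → w + a k · binomℚ t k) (h t p)))
                     (Poly-· (- a k) (Poly-binom k t₀)))

-- C(t−1,k) − C(t,k) has degree < k for t ≥ 1: by Pascal's rule it equals
-- −C(t−1,k−1) = −(C(t,k−1) + (C(t−1,k−1) − C(t,k−1))), and induction on k.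
binom-pred-diff : ∀ k → Poly k 1 (λ t → binomℚ (pred t) k - binomℚ t k)
binom-pred-diff zero    = poly (λ _ → 0ℚ) (λ t _ → refl)
binom-pred-diff (suc k) =
  Poly-congr shifted
    (Poly-· (- 1ℚ) (Poly-+ (Poly-binom k 1) (Poly-embed (binom-pred-diff k))))
  where
  shifted : ∀ t → 1 ≤ t → - 1ℚ · (binomℚ t k + (binomℚ (pred t) k - binomℚ t k))
                        ≡ binomℚ (pred t) (suc k) - binomℚ t (suc k)
  shifted (suc s) _ = begin
    - 1ℚ · (binomℚ (suc s) k + (binomℚ s k - binomℚ (suc s) k))
      ≡⟨ solve 3 (λ c₁ c₀ c → con (- 1ℚ) :* (c :+ (c₀ :- c)) := c₁ :- (c₁ :+ c₀))
           refl (binomℚ s (suc k)) (binomℚ s k) (binomℚ (suc s) k) ⟩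
    binomℚ s (suc k) - (binomℚ s (suc k) + binomℚ s k)
      ≡⟨ cong (λ w → binomℚ s (suc k) - w) (sym (pascal s k)) ⟩
    binomℚ s (suc k) - binomℚ (suc s) (suc k) ∎

binom-pred : ∀ k → Poly (suc k) 1 (λ t → binomℚ (pred t) k)
binom-pred k =
  Poly-congr (λ t _ → solve 2 (λ c p → c :+ (p :- c) := p) refl (binomℚ t k) (binomℚ (pred t) k))
             (Poly-+ (Poly-binom k 1) (Poly-embed (binom-pred-diff k)))

combo-pred : ∀ k a → Poly k 1 (λ t → combo k a (pred t))
combo-pred zero    a = poly a (λ _ _ → refl)
combo-pred (suc k) a = Poly-+ (Poly-embed (combo-pred k a)) (Poly-· (a k) (binom-pred k))

Poly-pred : ∀ {k t₀ f} → Poly k t₀ f → Poly k (suc t₀) (λ t → f (pred t))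
Poly-pred {k} (poly a h) =
  Poly-congr (λ t p → sym (h (pred t) (ℕP.pred-mono-≤ p)))
             (Poly-raise (s≤s z≤n) (combo-pred k a))

Monic-pred : ∀ {k t₀ f} → Monic k t₀ f → Monic k (suc t₀) (λ t → f (pred t))
Monic-pred {k} {f = f} m =
  Poly-congr (λ t _ → solve 3 (λ F p c → (F :- p) :+ (p :- c) := F :- c)
                              refl (f (pred t)) (binomℚ (pred t) k) (binomℚ t k))
             (Poly-+ (Poly-pred m) (Poly-raise (s≤s z≤n) (binom-pred-diff k)))

-- Σ_{n<k} a n · C(t,n+1), an antidifference of combo k a (by Pascal's rule).
antidiff : ℕ → (ℕ → ℚ) → ℕ → ℚ
antidiff zero    a t = 0ℚ
antidiff (suc k) a t = antidiff k a t + a k · binomℚ t (suc k)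

antidiff-step : ∀ k a t → antidiff k a (suc t) ≡ antidiff k a t + combo k a t
antidiff-step zero    a t = solve 0 (con 0ℚ := con 0ℚ :+ con 0ℚ) refl
antidiff-step (suc k) a t = begin
  antidiff k a (suc t) + a k · binomℚ (suc t) (suc k)
    ≡⟨ cong₂ (λ u v → u + a k · v) (antidiff-step k a t) (pascal t k) ⟩
  (antidiff k a t + combo k a t) + a k · (binomℚ t (suc k) + binomℚ t k)
    ≡⟨ solve 5 (λ U T x c₁ c₀ → (U :+ T) :+ x :* (c₁ :+ c₀) := (U :+ x :* c₁) :+ (T :+ x :* c₀))
         refl (antidiff k a t) (combo k a t) (a k) (binomℚ t (suc k)) (binomℚ t k) ⟩
  antidiff (suc k) a t + combo (suc k) a t ∎

prepend : ℚ → (ℕ → ℚ) → ℕ → ℚ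
prepend K a zero    = K
prepend K a (suc n) = a n

combo-prepend : ∀ k K a t → combo (suc k) (prepend K a) t ≡ K + antidiff k a t
combo-prepend zero    K a t = solve 1 (λ K → con 0ℚ :+ K :* con 1ℚ := K :+ con 0ℚ) refl K
combo-prepend (suc k) K a t = begin
  combo (suc k) (prepend K a) t + a k · binomℚ t (suc k)
    ≡⟨ cong (λ w → w + a k · binomℚ t (suc k)) (combo-prepend k K a t) ⟩
  (K + antidiff k a t) + a k · binomℚ t (suc k)
    ≡⟨ solve 3 (λ K U x → (K :+ U) :+ x := K :+ (U :+ x)) refl K (antidiff k a t) (a k · binomℚ t (suc k)) ⟩
  K + antidiff (suc k) a t ∎

constant-from : ∀ {t₀} (h : ℕ → ℚ) → (∀ t → t₀ ≤ t → h (suc t) ≡ h t) →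
                ∀ t → t₀ ≤ t → h t ≡ h t₀
constant-from {t₀} h flat t t₀≤t = go (ℕP.≤⇒≤′ t₀≤t)
  where
  go : ∀ {t} → t₀ ≤′ t → h t ≡ h t₀
  go ≤′-refl         = refl
  go (≤′-step {s} q) = trans (flat s (ℕP.≤′⇒≤ q)) (go q)

-- Summation raises the degree by one: if Δf = g has degree < k, then f has
-- degree < k+1, namely f = f(t₀) − antidiff(t₀) + antidiff.
Poly-sum : ∀ {k t₀ f g} → Poly k t₀ g → (∀ t → t₀ ≤ t → f (suc t) ≡ f t + g t) →
           Poly (suc k) t₀ f
Poly-sum {k} {t₀} {f} {g} (poly a h) step = poly (prepend (rest t₀) a) (λ t p → begin
  f t                        ≡⟨ solve 2 (λ F U → F := (F :- U) :+ U) refl (f t) (antidiff k a t) ⟩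
  rest t + antidiff k a t    ≡⟨ cong (λ w → w + antidiff k a t) (constant-from rest flat t p) ⟩
  rest t₀ + antidiff k a t   ≡⟨ sym (combo-prepend k (rest t₀) a t) ⟩
  combo (suc k) (prepend (rest t₀) a) t ∎)
  where
  rest : ℕ → ℚ
  rest t = f t - antidiff k a t
  flat : ∀ t → t₀ ≤ t → rest (suc t) ≡ rest t
  flat t p = begin
    f (suc t) - antidiff k a (suc t)
      ≡⟨ cong₂ _-_ (step t p) (antidiff-step k a t) ⟩
    (f t + g t) - (antidiff k a t + combo k a t)
      ≡⟨ cong (λ w → (f t + w) - (antidiff k a t + combo k a t)) (h t p) ⟩
    (f t + combo k a t) - (antidiff k a t + combo k a t)
      ≡⟨ solve 3 (λ F T U → (F :+ T) :- (U :+ T) := F :- U) refl (f t) (combo k a t) (antidiff k a t) ⟩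
    f t - antidiff k a t ∎

-- The same for monic functions, via Pascal's rule ΔC(t,k+1) = C(t,k).
Monic-sum : ∀ {k t₀ f g} → Monic k t₀ g → (∀ t → t₀ ≤ t → f (suc t) ≡ f t + g t) →
            Monic (suc k) t₀ f
Monic-sum {k} {t₀} {f} {g} m step = Poly-sum m step′
  where
  step′ : ∀ t → t₀ ≤ t → f (suc t) - binomℚ (suc t) (suc k)
                       ≡ (f t - binomℚ t (suc k)) + (g t - binomℚ t k)
  step′ t p = begin
    f (suc t) - binomℚ (suc t) (suc k)
      ≡⟨ cong₂ _-_ (step t p) (pascal t k) ⟩
    (f t + g t) - (binomℚ t (suc k) + binomℚ t k)
      ≡⟨ solve 4 (λ F G c₁ c₀ → (F :+ G) :- (c₁ :+ c₀) := (F :- c₁) :+ (G :- c₀))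
           refl (f t) (g t) (binomℚ t (suc k)) (binomℚ t k) ⟩
    (f t - binomℚ t (suc k)) + (g t - binomℚ t k) ∎

Monic-affine : ∀ {k t₀ f g} x → Monic k t₀ f → Monic k t₀ g →
               Monic k t₀ (λ t → x · f t + (1ℚ - x) · g t)
Monic-affine {k} {f = f} {g = g} x mf mg =
  Poly-congr (λ t _ → solve 4 (λ x F G c → x :* (F :- c) :+ (con 1ℚ :- x) :* (G :- c)
                                          := (x :* F :+ (con 1ℚ :- x) :* G) :- c)
                              refl x (f t) (g t) (binomℚ t k))
             (Poly-+ (Poly-· x mf) (Poly-· (1ℚ - x) mg))

two : ℚ
two = ι (+ 2)

d-step : ∀ j s → 2 * suc j < suc (suc s) →
         d (suc j) (suc (suc s)) ≡ (+ 2 ℤ.* d j (suc s)) ℤ.+ d (suc j) (suc s) ℤ.- d j s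
d-step j s lt rewrite Equivalence.to T-≡ (ℕP.<⇒<ᵇ lt) = refl

d-difference : ∀ j t → 2 * suc j ≤ t →
               dℚ (suc j) (suc t) ≡ dℚ (suc j) t + (two · dℚ j t + (1ℚ - two) · dℚ j (pred t))
d-difference j (suc s) p = begin
  ι (d (suc j) (suc (suc s)))
    ≡⟨ cong ι (d-step j s (s≤s p)) ⟩
  ι ((+ 2 ℤ.* d j (suc s)) ℤ.+ d (suc j) (suc s) ℤ.- d j s)
    ≡⟨ ι-- ((+ 2 ℤ.* d j (suc s)) ℤ.+ d (suc j) (suc s)) (d j s) ⟩
  ι ((+ 2 ℤ.* d j (suc s)) ℤ.+ d (suc j) (suc s)) - ι (d j s)
    ≡⟨ cong (λ w → w - ι (d j s)) (ι-+ (+ 2 ℤ.* d j (suc s)) (d (suc j) (suc s))) ⟩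
  ι (+ 2 ℤ.* d j (suc s)) + ι (d (suc j) (suc s)) - ι (d j s)
    ≡⟨ cong (λ w → w + ι (d (suc j) (suc s)) - ι (d j s)) (ι-* (+ 2) (d j (suc s))) ⟩
  two · ι (d j (suc s)) + ι (d (suc j) (suc s)) - ι (d j s)
    ≡⟨ solve 3 (λ x y z → con two :* x :+ y :- z := y :+ (con two :* x :+ (con 1ℚ :- con two) :* z))
         refl (ι (d j (suc s))) (ι (d (suc j) (suc s))) (ι (d j s)) ⟩
  ι (d (suc j) (suc s)) + (two · ι (d j (suc s)) + (1ℚ - two) · ι (d j s)) ∎

d-monic : ∀ i → Monic i (2 * i) (dℚ i)
d-monic zero    = poly (λ _ → 0ℚ) (λ t _ → refl)
d-monic (suc j) = Monic-sum {f = dℚ (suc j)} increment (d-difference j)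
  where
  bound : suc (2 * j) ≤ 2 * suc j
  bound = ℕP.≤-trans (ℕP.n≤1+n _) (ℕP.≤-reflexive (sym (ℕP.*-suc 2 j)))
  increment : Monic j (2 * suc j) (λ t → two · dℚ j t + (1ℚ - two) · dℚ j (pred t))
  increment = Poly-raise bound (Monic-affine {f = dℚ j} {g = λ t → dℚ j (pred t)} two
                               (Poly-raise (ℕP.n≤1+n _) (d-monic j))
                               (Monic-pred {f = dℚ j} (d-monic j)))

sumBinom≡combo : ∀ k (c : Fin k → ℚ) a t → (∀ n → c n ≡ a (toℕ n)) → sumBinom k c t ≡ combo k a t
sumBinom≡combo zero    c a t c≡a = refl
sumBinom≡combo (suc k) c a t c≡a =
  cong₂ (λ u v → u + v · binomℚ t k)
        (sumBinom≡combo k (λ n → c (inject₁ n)) a t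
                        (λ n → trans (c≡a (inject₁ n)) (cong a (toℕ-inject₁ n))))
        (trans (c≡a (fromℕ k)) (cong a (toℕ-fromℕ k)))

corollary1 : (i : ℕ) → Σ (Fin i → ℚ) (λ c → (t : ℕ) → 2 * i ≤ t → dℚ i t ≡ pBinom i c t)
corollary1 i = (λ n → coeff (toℕ n)) , λ t 2i≤t → begin
  dℚ i t                                  ≡⟨ solve 2 (λ x c → x := c :+ (x :- c)) refl (dℚ i t) (binomℚ t i) ⟩
  binomℚ t i + (dℚ i t - binomℚ t i)      ≡⟨ cong (λ w → binomℚ t i + w) (agree t 2i≤t) ⟩
  binomℚ t i + combo i coeff t            ≡⟨ cong (λ w → binomℚ t i + w) (sym (sumBinom≡combo i _ coeff t (λ _ → refl))) ⟩
  pBinom i (λ n → coeff (toℕ n)) t        ∎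
  where open Poly (d-monic i)
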